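{- Every monotone multilinear Boolean circuit is a read-$1$ circuit. In particular, $\mathrm{Read}_1(f)\leq\mathrm{mLin}(f)$ for every non-constant monotone Boolean function $f$.
   Context: A monotone Boolean circuit is a directed acyclic graph (parallel edges allowed) whose indegree-zero nodes hold variables among $x_1,\dots,x_n$ (no constants) and whose gates have indegree two and are labeled $\lor$ or $\land$; size = number of gates. It is multilinear if the two Boolean functions computed at the inputs of every AND gate depend on disjoint sets of variables (a function depends on $x_i$ if its value differs on some two inputs differing only in position $i$). The set $B_F\subseteq\mathbb{N}^n$ of exponent vectors produced by $F$: $B_{x_i}=\{e_i\}$, $B_{G\lor H}=B_G\cup B_H$, $B_{G\land H}=\{b+c:b\in B_G,c\in B_H\}$. For monotone $f$, $\mathrm{Low}(f)$ is the set of $a\in\{0,1\}^n$ with $f(a)=1$ and $f(b)=0$ for all $b\leq a$, $b\neq a$. A monotone circuit computing $f$ is a read-$1$ circuit if $\mathrm{Low}(f)\subseteq B_F$. $\mathrm{Read}_1(f)$ is the minimum size of a read-$1$ circuit computing $f$, and $\mathrm{mLin}(f)$ the minimum size of a monotone multilinear circuit computing $f$. -}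

module Defs where

open import Data.Nat using (ℕ; zero; suc; _+_)
open import Data.Bool using (Bool; true; false; _∧_; _∨_; not; if_then_else_; _≤_)
open import Data.Fin using (Fin; zero; suc; _≟_)
open import Data.Sum using (_⊎_; inj₁; inj₂)
open import Data.Product using (_×_; Σ; ∃; ∃-syntax; _,_)
open import Data.Unit using (⊤)
open import Data.Empty using (⊥)
open import Relation.Nullary using (¬_; yes; no)
open import Relation.Binary.PropositionalEquality using (_≡_; _≢_)

Assignment : ℕ → Set
Assignment n = Fin n → Bool

BoolFun : ℕ → Set
BoolFun n = Assignment n → Bool

flipAt : ∀ {n} → Fin n → Assignment n → Assignment n
flipAt i a j with i ≟ j
... | yes _ = not (a j)
... | no  _ = a j

DependsOn : ∀ {n} → BoolFun n → Fin n → Set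
DependsOn f i = ∃[ a ] f a ≢ f (flipAt i a)

_≤ₐ_ : ∀ {n} → Assignment n → Assignment n → Set
a ≤ₐ b = ∀ j → a j ≤ b j

Monotone : ∀ {n} → BoolFun n → Set
Monotone f = ∀ a b → a ≤ₐ b → f a ≤ f b

NonConstant : ∀ {n} → BoolFun n → Set
NonConstant f = ∃[ a ] ∃[ b ] f a ≢ f b

Low : ∀ {n} → BoolFun n → Assignment n → Set
Low f a = f a ≡ true × (∀ b → b ≤ₐ a → (∃[ j ] b j ≢ a j) → f b ≡ false)

-- Monotone Boolean circuits as straight-line programs (DAGs).  A node of a circuit with s gates is either a variable
-- (inj₁ i) or a gate (inj₂ k), where gates are indexed from the most
-- recently added one (inj₂ zero = last gate).

data Op : Set where
  OR AND : Op

Node : ℕ → ℕ → Set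
Node n s = Fin n ⊎ Fin s

Gate : ℕ → ℕ → Set
Gate n s = Op × Node n s × Node n s

data Circ (n : ℕ) : ℕ → Set where
  []  : Circ n zero
  _▷_ : ∀ {s} → Circ n s → Gate n s → Circ n (suc s)

-- size = number of gates = the index s

evalOp : Op → Bool → Bool → Bool
evalOp OR  x y = x ∨ y
evalOp AND x y = x ∧ y

value : ∀ {n s} → Circ n s → Node n s → BoolFun n
value C (inj₁ i) a = a i
value (C ▷ (op , u , v)) (inj₂ zero) a = evalOp op (value C u a) (value C v a)
value (C ▷ g) (inj₂ (suc k)) a = value C (inj₂ k) a

Multilinear : ∀ {n s} → Circ n s → Set
Multilinear [] = ⊤
Multilinear (C ▷ (OR , u , v)) = Multilinear C
Multilinear (C ▷ (AND , u , v)) =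
  Multilinear C × (∀ i → DependsOn (value C u) i → DependsOn (value C v) i → ⊥)

ExpVec : ℕ → Set
ExpVec n = Fin n → ℕ

unitVec : ∀ {n} → Fin n → ExpVec n
unitVec i j with i ≟ j
... | yes _ = 1
... | no  _ = 0

-- B_F as a predicate on exponent vectors (membership up to pointwise equality)
B : ∀ {n s} → Circ n s → Node n s → ExpVec n → Set
B C (inj₁ i) b = ∀ j → b j ≡ unitVec i j
B (C ▷ (OR , u , v)) (inj₂ zero) b = B C u b ⊎ B C v b
B (C ▷ (AND , u , v)) (inj₂ zero) b =
  ∃[ c ] ∃[ d ] (B C u c × B C v d × (∀ j → b j ≡ c j + d j))
B (C ▷ g) (inj₂ (suc k)) b = B C (inj₂ k) b

toExp : ∀ {n} → Assignment n → ExpVec n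
toExp a j = if a j then 1 else 0

Computes : ∀ {n s} → Circ n s → Node n s → BoolFun n → Set
Computes C o f = ∀ a → value C o a ≡ f a

Read1 : ∀ {n s} → Circ n s → Node n s → Set
Read1 C o = ∀ a → Low (value C o) a → B C o (toExp a)

{-# OPTIONS --safe #-}
-- A minimal input of x_i is e_i, and a minimal
-- input of g ∨ h is minimal for g or for h.  At a multilinear AND gate, let a
-- be a minimal input of g ∧ h.  Clearing any set bit of a falsifies g or h,
-- and not both: otherwise g and h would both depend on that variable.  So the
-- set bits of a split into those whose clearing falsifies g (forming a₁) and
-- those whose clearing falsifies h (forming a₂), with a = a₁ + a₂.  Since g
-- ignores the bits of a₂ and h those of a₁, a₁ is a minimal input of g and a₂
-- one of h.
module Submission where

open import Defs
open import Data.Bool as Bool using (Bool; true; false; _∧_; _∨_; not; b≤b; f≤t)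
open import Data.Bool.Properties
  using (∨-identityʳ; ∨-zeroʳ; ∨-conicalˡ; ∨-conicalʳ; ∧-identityʳ; ∧-comm;
         ∧-conicalˡ; ∧-conicalʳ; ≤-minimum; ≤-maximum; ¬-not)
open import Data.Empty using (⊥; ⊥-elim)
open import Data.Fin using (Fin; zero; suc; _≟_)
open import Data.List using (List; []; _∷_; foldr; allFin)
open import Data.List.Membership.Propositional using (_∈_)
open import Data.List.Membership.Propositional.Properties using (∈-allFin)
open import Data.List.Relation.Unary.Any using (here; there)
open import Data.Nat using (ℕ; _≤_; _+_)
open import Data.Nat.Properties using (≤-refl)
open import Data.Product using (_×_; ∃-syntax; _,_; proj₁; proj₂)
open import Data.Sum as Sum using (_⊎_; inj₁; inj₂)
open import Relation.Nullary using (¬_; yes; no)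
open import Relation.Binary.PropositionalEquality

private
  variable
    n s : ℕ

Extensional : BoolFun n → Set
Extensional f = ∀ {x y} → x ≗ y → f x ≡ f y

value-extensional : (C : Circ n s) (o : Node n s) → Extensional (value C o)
value-extensional C (inj₁ i) x≗y = x≗y i
value-extensional (C ▷ (op , u , v)) (inj₂ zero) x≗y =
  cong₂ (evalOp op) (value-extensional C u x≗y) (value-extensional C v x≗y)
value-extensional (C ▷ g) (inj₂ (suc k)) = value-extensional C (inj₂ k)

Independent : BoolFun n → Fin n → Set
Independent f j = ∀ x → f x ≡ f (flipAt j x)

¬DependsOn⇒Independent : (f : BoolFun n) (j : Fin n) → ¬ DependsOn f j → Independent f j
¬DependsOn⇒Independent f j ¬dep x with f x Bool.≟ f (flipAt j x)
... | yes eq = eq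
... | no neq = ⊥-elim (¬dep (x , neq))

update : Assignment n → Fin n → Bool → Assignment n
update z k v i with k ≟ i
... | yes _ = v
... | no  _ = z i

update-at : (z : Assignment n) (k : Fin n) (v : Bool) → update z k v k ≡ v
update-at z k v with k ≟ k
... | yes _ = refl
... | no k≢k = ⊥-elim (k≢k refl)

update-elsewhere : (z : Assignment n) {k i : Fin n} (v : Bool) → k ≢ i → update z k v i ≡ z i
update-elsewhere z {k} {i} v k≢i with k ≟ i
... | yes k≡i = ⊥-elim (k≢i k≡i)
... | no _ = refl

update-unchanged : (z : Assignment n) (k : Fin n) {v : Bool} → v ≡ z k → update z k v ≗ z
update-unchanged z k v≡zk i with k ≟ i
... | yes refl = v≡zk
... | no _ = refl

update-flipAt : (z : Assignment n) (k : Fin n) {v : Bool} → v ≡ not (z k) → update z k v ≗ flipAt k z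
update-flipAt z k v≡¬zk i with k ≟ i
... | yes refl = v≡¬zk
... | no _ = refl

update-invariant : (f : BoolFun n) → Extensional f → (z : Assignment n) (k : Fin n) (v : Bool) →
                   v ≡ z k ⊎ Independent f k → f z ≡ f (update z k v)
update-invariant f ext z k v (inj₁ v≡zk) = sym (ext (update-unchanged z k v≡zk))
update-invariant f ext z k v (inj₂ indep) with v Bool.≟ z k
... | yes v≡zk = sym (ext (update-unchanged z k v≡zk))
... | no v≢zk = trans (indep z) (sym (ext (update-flipAt z k (¬-not v≢zk))))

-- x is turned into y one coordinate at a time, along the list allFin n.
module _ (f : BoolFun n) (ext : Extensional f) (x y : Assignment n)
         (agree : ∀ j → x j ≡ y j ⊎ Independent f j) where

  private
    hybrid : List (Fin n) → Assignment n
    hybrid = foldr (λ k z → update z k (y k)) x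

    hybrid-between : ∀ L j → hybrid L j ≡ x j ⊎ hybrid L j ≡ y j
    hybrid-between [] j = inj₁ refl
    hybrid-between (k ∷ L) j with k ≟ j
    ... | yes refl = inj₂ refl
    ... | no _ = hybrid-between L j

    hybrid-∈ : ∀ L j → j ∈ L → hybrid L j ≡ y j
    hybrid-∈ (k ∷ L) j (here refl) = update-at (hybrid L) j (y j)
    hybrid-∈ (k ∷ L) j (there j∈L) with k ≟ j
    ... | yes refl = refl
    ... | no _ = hybrid-∈ L j j∈L

    hybrid-invariant : ∀ L → f x ≡ f (hybrid L)
    hybrid-invariant [] = refl
    hybrid-invariant (k ∷ L) =
      trans (hybrid-invariant L) (update-invariant f ext (hybrid L) k (y k) step)
      where
      step : y k ≡ hybrid L k ⊎ Independent f k
      step with agree k | hybrid-between L k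
      ... | inj₂ indep | _ = inj₂ indep
      ... | inj₁ xk≡yk | inj₁ eq = inj₁ (sym (trans eq xk≡yk))
      ... | inj₁ _ | inj₂ eq = inj₁ (sym eq)

  agree-on-dependent-positions : f x ≡ f y
  agree-on-dependent-positions =
    trans (hybrid-invariant (allFin n)) (ext (λ j → hybrid-∈ (allFin n) j (∈-allFin j)))

clear : Fin n → Assignment n → Assignment n
clear j a = update a j false

clear-≤ : (j : Fin n) (a : Assignment n) → clear j a ≤ₐ a
clear-≤ j a i with j ≟ i
... | yes _ = ≤-minimum (a i)
... | no _ = b≤b

clear≗flipAt : (j : Fin n) (a : Assignment n) → a j ≡ true → clear j a ≗ flipAt j a
clear≗flipAt j a aj≡true = update-flipAt a j (sym (cong not aj≡true))

Low-clear : {f : BoolFun n} {a : Assignment n} → Low f a →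
            (j : Fin n) → a j ≡ true → f (clear j a) ≡ false
Low-clear {a = a} (_ , minimal) j aj≡true =
  minimal (clear j a) (clear-≤ j a) (j , λ eq → clear≢ (trans eq aj≡true))
  where
  clear≢ : clear j a j ≢ true
  clear≢ eq with trans (sym (update-at a j false)) eq
  ... | ()

clear-DependsOn : (f : BoolFun n) → Extensional f → {a : Assignment n} (j : Fin n) →
                  f a ≡ true → a j ≡ true → f (clear j a) ≡ false → DependsOn f j
clear-DependsOn f ext {a} j fa≡true aj≡true fclear≡false =
  a , λ eq → true≢false (begin
    true                 ≡⟨ sym fa≡true ⟩
    f a                  ≡⟨ eq ⟩
    f (flipAt j a)       ≡⟨ ext (λ i → sym (clear≗flipAt j a aj≡true i)) ⟩
    f (clear j a)        ≡⟨ fclear≡false ⟩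
    false                ∎)
  where
  open ≡-Reasoning
  true≢false : true ≢ false
  true≢false ()

≤∧≢⇒false-true : {x y : Bool} → x Bool.≤ y → x ≢ y → x ≡ false × y ≡ true
≤∧≢⇒false-true b≤b x≢x = ⊥-elim (x≢x refl)
≤∧≢⇒false-true f≤t _ = refl , refl

Low-variable : (i : Fin n) {a : Assignment n} → Low (λ x → x i) a → toExp a ≗ unitVec i
Low-variable i {a} low@(ai≡true , _) j with i ≟ j
... | yes refl = cong (λ b → Bool.if b then 1 else 0) ai≡true
... | no i≢j with a j in aj≡true
... | false = refl
... | true with trans (sym ai≡true)
                 (trans (sym (update-elsewhere a false (λ j≡i → i≢j (sym j≡i))))
                        (Low-clear low j aj≡true))
... | ()

Low-∨ : {g h : BoolFun n} {a : Assignment n} → Low (λ x → g x ∨ h x) a → Low g a ⊎ Low h a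
Low-∨ {g = g} {a = a} (ga∨ha≡true , minimal) with g a
... | true = inj₁ (refl , λ b b≤a b≢a → ∨-conicalˡ _ _ (minimal b b≤a b≢a))
... | false = inj₂ (ga∨ha≡true , λ b b≤a b≢a → ∨-conicalʳ _ _ (minimal b b≤a b≢a))

part : Assignment n → BoolFun n → Assignment n
part a g j = a j ∧ not (g (clear j a))

module AndSplit (g h : BoolFun n) (ext-g : Extensional g) (ext-h : Extensional h)
                (disjoint : ∀ i → DependsOn g i → DependsOn h i → ⊥)
                (a : Assignment n) (low : Low (λ x → g x ∧ h x) a) where

  ga≡true : g a ≡ true
  ga≡true = ∧-conicalˡ _ _ (proj₁ low)

  ha≡true : h a ≡ true
  ha≡true = ∧-conicalʳ _ _ (proj₁ low)

  data Owner (j : Fin n) : Set where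
    unset : a j ≡ false → Owner j
    of-g  : a j ≡ true → g (clear j a) ≡ false → h (clear j a) ≡ true →
            Independent h j → Owner j
    of-h  : a j ≡ true → g (clear j a) ≡ true → h (clear j a) ≡ false →
            Independent g j → Owner j

  owner : (j : Fin n) → Owner j
  owner j with a j in aj≡
  ... | false = unset aj≡
  ... | true with g (clear j a) in gc≡ | h (clear j a) in hc≡
  ... | false | false =
    ⊥-elim (disjoint j (clear-DependsOn g ext-g j ga≡true aj≡ gc≡)
                       (clear-DependsOn h ext-h j ha≡true aj≡ hc≡))
  ... | false | true =
    of-g aj≡ gc≡ hc≡ (¬DependsOn⇒Independent h j
      (disjoint j (clear-DependsOn g ext-g j ga≡true aj≡ gc≡)))
  ... | true | false =
    of-h aj≡ gc≡ hc≡ (¬DependsOn⇒Independent g j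
      (λ dep-g → disjoint j dep-g (clear-DependsOn h ext-h j ha≡true aj≡ hc≡)))
  ... | true | true with trans (sym (cong₂ _∧_ gc≡ hc≡)) (Low-clear low j aj≡)
  ... | ()

  toExp-part-sum : ∀ j → toExp a j ≡ toExp (part a g) j + toExp (part a h) j
  toExp-part-sum j with owner j
  ... | unset aj≡ rewrite aj≡ = refl
  ... | of-g aj≡ gc≡ hc≡ _ rewrite aj≡ | gc≡ | hc≡ = refl
  ... | of-h aj≡ gc≡ hc≡ _ rewrite aj≡ | gc≡ | hc≡ = refl

  part-agrees : ∀ j → part a g j ≡ a j ⊎ Independent g j
  part-agrees j with owner j
  ... | unset aj≡ rewrite aj≡ = inj₁ refl
  ... | of-g aj≡ gc≡ _ _ rewrite aj≡ | gc≡ = inj₁ refl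
  ... | of-h _ _ _ indep = inj₂ indep

  module _ (b : Assignment n) (b≤part : b ≤ₐ part a g) where

    b' : Assignment n
    b' j = b j ∨ part a h j

    b≡false-where-unset : ∀ j → a j ≡ false → b j ≡ false
    b≡false-where-unset j aj≡ with b j | b≤part j
    ... | false | _ = refl
    ... | true | le rewrite aj≡ with le
    ... | ()

    b'-agrees-b : ∀ j → b' j ≡ b j ⊎ Independent g j
    b'-agrees-b j with owner j
    ... | unset aj≡ rewrite aj≡ = inj₁ (∨-identityʳ (b j))
    ... | of-g aj≡ _ hc≡ _ rewrite aj≡ | hc≡ = inj₁ (∨-identityʳ (b j))
    ... | of-h _ _ _ indep = inj₂ indep

    b'-agrees-a : ∀ j → b' j ≡ a j ⊎ Independent h j
    b'-agrees-a j with owner j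
    ... | of-g _ _ _ indep = inj₂ indep
    ... | of-h aj≡ gc≡ hc≡ _ rewrite aj≡ | hc≡ = inj₁ (∨-zeroʳ (b j))
    ... | unset aj≡ rewrite b≡false-where-unset j aj≡ | aj≡ = inj₁ refl

    b'≤a : b' ≤ₐ a
    b'≤a j with owner j
    ... | of-g aj≡ _ _ _ rewrite aj≡ = ≤-maximum _
    ... | of-h aj≡ _ _ _ rewrite aj≡ = ≤-maximum _
    ... | unset aj≡ rewrite b≡false-where-unset j aj≡ | aj≡ = b≤b

    b'≢a : ∀ j → b j ≢ part a g j → b' j ≢ a j
    b'≢a j b≢part with ≤∧≢⇒false-true (b≤part j) b≢part | owner j
    ... | bj≡ , part≡ | unset aj≡ rewrite aj≡ with part≡
    ... | ()
    b'≢a j b≢part | bj≡ , part≡ | of-h aj≡ gc≡ _ _ rewrite aj≡ | gc≡ with part≡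
    ... | ()
    b'≢a j b≢part | bj≡ , _ | of-g aj≡ _ hc≡ _ rewrite bj≡ | aj≡ | hc≡ = λ ()

    g-below-part : (∃[ j ] b j ≢ part a g j) → g b ≡ false
    g-below-part (j , b≢part) = begin
      g b          ≡⟨ sym (agree-on-dependent-positions g ext-g b' b b'-agrees-b) ⟩
      g b'         ≡⟨ sym (∧-identityʳ (g b')) ⟩
      g b' ∧ true  ≡⟨ cong (g b' ∧_) (sym h-b'≡true) ⟩
      g b' ∧ h b'  ≡⟨ proj₂ low b' b'≤a (j , b'≢a j b≢part) ⟩
      false        ∎
      where
      open ≡-Reasoning
      h-b'≡true : h b' ≡ true
      h-b'≡true = trans (agree-on-dependent-positions h ext-h b' a b'-agrees-a) ha≡true

  Low-part : Low g (part a g)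
  Low-part = trans (agree-on-dependent-positions g ext-g (part a g) a part-agrees) ga≡true
           , λ b b≤part b≢part → g-below-part b b≤part b≢part

Low-∧-split : (g h : BoolFun n) → Extensional g → Extensional h →
              (∀ i → DependsOn g i → DependsOn h i → ⊥) →
              (a : Assignment n) → Low (λ x → g x ∧ h x) a →
              ∃[ a₁ ] ∃[ a₂ ] (Low g a₁ × Low h a₂ × (∀ j → toExp a j ≡ toExp a₁ j + toExp a₂ j))
Low-∧-split g h ext-g ext-h disjoint a low@(ga∧ha≡true , minimal) =
  part a g , part a h , G.Low-part , H.Low-part , G.toExp-part-sum
  where
  module G = AndSplit g h ext-g ext-h disjoint a low
  module H = AndSplit h g ext-h ext-g (λ i dep-h dep-g → disjoint i dep-g dep-h) a
               (trans (∧-comm (h a) (g a)) ga∧ha≡true ,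
                λ b b≤a b≢a → trans (∧-comm (h b) (g b)) (minimal b b≤a b≢a))

multilinear⇒Read1 : (C : Circ n s) → Multilinear C → (o : Node n s) → Read1 C o
multilinear⇒Read1 C ml (inj₁ i) a low = Low-variable i low
multilinear⇒Read1 (C ▷ (OR , u , v)) ml (inj₂ zero) a low =
  Sum.map (multilinear⇒Read1 C ml u a) (multilinear⇒Read1 C ml v a) (Low-∨ low)
multilinear⇒Read1 (C ▷ (AND , u , v)) (ml , disjoint) (inj₂ zero) a low
  with Low-∧-split (value C u) (value C v) (value-extensional C u) (value-extensional C v)
                   disjoint a low
... | a₁ , a₂ , low₁ , low₂ , sum =
  toExp a₁ , toExp a₂ , multilinear⇒Read1 C ml u a₁ low₁ , multilinear⇒Read1 C ml v a₂ low₂ , sum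
multilinear⇒Read1 (C ▷ (OR , u , v)) ml (inj₂ (suc k)) = multilinear⇒Read1 C ml (inj₂ k)
multilinear⇒Read1 (C ▷ (AND , u , v)) (ml , _) (inj₂ (suc k)) = multilinear⇒Read1 C ml (inj₂ k)

lemma7 : ((n s : ℕ) (C : Circ n s) (o : Node n s) → Multilinear C → Read1 C o)
    × ((n : ℕ) (f : BoolFun n) → Monotone f → NonConstant f →
       (s : ℕ) (C : Circ n s) (o : Node n s) → Multilinear C → Computes C o f →
       ∃[ s' ] ∃[ C' ] ∃[ o' ] (s' ≤ s × Computes {n} {s'} C' o' f × Read1 C' o'))
lemma7 = (λ n s C o ml → multilinear⇒Read1 C ml o)
       , (λ n f _ _ s C o ml computes → s , C , o , ≤-refl , computes , multilinear⇒Read1 C ml o)
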